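{- Let $\mathbf{a}=(a_n)_{n\geq 1}$ be a strong divisibility sequence. Then for every non-negative integer $n$, \[\mathrm{lcm}\left\{\binom{n}{0}_{\mathbf{a}},\binom{n}{1}_{\mathbf{a}},\dots,\binom{n}{n}_{\mathbf{a}}\right\}=\frac{\mathrm{lcm}(a_1,a_2,\dots,a_n,a_{n+1})}{a_{n+1}}.\]
   Context: A strong divisibility sequence is a sequence of positive integers $(a_n)_{n\geq 1}$ such that $\gcd(a_n,a_m)=a_{\gcd(n,m)}$ for all positive integers $n,m$. For $n,k\in\mathbb{N}$ with $n\geq k$, the $\mathbf{a}$-binomial coefficient is $\binom{n}{k}_{\mathbf{a}}:=\frac{a_na_{n-1}\cdots a_{n-k+1}}{a_1a_2\cdots a_k}$ (an empty product being $1$). For such sequences these coefficients are positive integers. $\mathrm{lcm}$ denotes the least common positive multiple. -}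

module Defs where

open import Data.Nat using (ℕ; zero; suc; _+_; _*_; _∸_; _≤_; _<_)
open import Data.Nat.DivMod using (_/_)
open import Data.Nat.GCD using (gcd)
open import Data.Nat.LCM using (lcm)
open import Data.List using (List; []; _∷_; map; foldr; upTo)
open import Relation.Binary.PropositionalEquality using (_≡_)
open import Data.Product using (_×_)

-- Sequences are functions ℕ → ℕ; only indices n ≥ 1 are meaningful
-- (the value at 0 is ignored by everything below).

IsStrongDivSeq : (ℕ → ℕ) → Set
IsStrongDivSeq a =
  (∀ n → 1 ≤ n → 0 < a n) ×
  (∀ n m → 1 ≤ n → 1 ≤ m → gcd (a n) (a m) ≡ a (gcd n m))

_÷_ : ℕ → ℕ → ℕ
m ÷ zero  = 0
m ÷ suc d = m / suc d

fallingProd : (ℕ → ℕ) → ℕ → ℕ → ℕ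
fallingProd a n zero    = 1
fallingProd a n (suc k) = a n * fallingProd a (n ∸ 1) k

prodUpTo : (ℕ → ℕ) → ℕ → ℕ
prodUpTo a zero    = 1
prodUpTo a (suc k) = prodUpTo a k * a (suc k)

binomA : (ℕ → ℕ) → ℕ → ℕ → ℕ
binomA a n k = fallingProd a n k ÷ prodUpTo a k

lcmList : List ℕ → ℕ
lcmList = foldr lcm 1

{-# OPTIONS --safe #-}
-- Fix a prime p and put f i = v_p(a_i). Strong divisibility gives f (gcd i j) = min (f i) (f j),
-- so for every t the indices i ≤ n + 1 with p^t ∣ a_i are exactly the multiples of a single
-- period ρ_t. Writing f i = Σ_t [t ≤ f i] and counting level by level, v_p of (n choose k)_a
-- becomes Σ_t (⌊n/ρ_t⌋ − ⌊k/ρ_t⌋ − ⌊(n−k)/ρ_t⌋), a sum of carries in {0,1}. The carry at level t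
-- vanishes when ρ_t ∣ n + 1 and otherwise forces ρ_t ≤ n, so level t is reached by some a_i with
-- i ≤ n + 1; hence (n choose k)_a · a_{n+1} divides lcm(a_1, …, a_{n+1}). Conversely, the
-- absorption identity (n+1 choose j)_a · a_j = (n choose j−1)_a · a_{n+1} shows that every a_j
-- divides (n choose j−1)_a · a_{n+1}.
module Submission where

open import Defs
open import Data.Nat
open import Data.Nat.Properties
open import Data.Nat.DivMod
open import Data.Nat.Divisibility
open import Data.Nat.GCD using (gcd; gcd[m,n]∣m; gcd[m,n]∣n; gcd-greatest; gcd[m,n]≢0)
open import Data.Nat.LCM using (lcm; m∣lcm[m,n]; n∣lcm[m,n]; lcm-least; gcd*lcm)
open import Data.Nat.Primality using (Prime; prime⇒nonZero; prime⇒nonTrivial; euclidsLemma)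
open import Data.Nat.Primality.Factorisation using (factorise)
open import Data.Nat.ListAction using (product)
open import Data.Nat.Induction using (<-rec)
open import Data.Nat.Tactic.RingSolver using (solve-∀)
open import Data.Empty using (⊥-elim)
open import Data.Sum using (_⊎_; inj₁; inj₂)
open import Data.Product using (Σ-syntax; _×_; _,_; proj₁; proj₂)
open import Data.List using ([]; _∷_; map; upTo)
open import Data.List.Relation.Unary.All using (All; []; _∷_)
open import Data.List.Relation.Unary.All.Properties using (map⁺; applyUpTo⁺₁)
open import Data.List.Relation.Unary.Any using (here; there)
open import Data.List.Membership.Propositional using (_∈_)
open import Data.List.Membership.Propositional.Properties using (∈-map⁺; ∈-upTo⁺)
open import Function using (_∘_; id; _⇔_; mk⇔; Equivalence)
open import Relation.Nullary using (¬_; Dec; yes; no; contradiction)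
open import Relation.Binary.PropositionalEquality

open Equivalence using (to; from)

carry : (d : ℕ) .{{_ : NonZero d}} → ℕ → ℕ → ℕ
carry d m n = (m % d + n % d) / d

module _ (d : ℕ) .{{_ : NonZero d}} where

  [m+n]/d≡m/d+n/d+carry : ∀ m n → (m + n) / d ≡ m / d + n / d + carry d m n
  [m+n]/d≡m/d+n/d+carry m n = begin
    (m + n) / d                                   ≡⟨ /-congˡ split ⟩
    (m % d + n % d + (m / d + n / d) * d) / d     ≡⟨ +-distrib-/-∣ʳ (m % d + n % d) (n∣m*n (m / d + n / d)) ⟩
    carry d m n + (m / d + n / d) * d / d         ≡⟨ cong (carry d m n +_) (m*n/n≡m (m / d + n / d) d) ⟩
    carry d m n + (m / d + n / d)                 ≡⟨ +-comm (carry d m n) _ ⟩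
    m / d + n / d + carry d m n                   ∎
    where
    open ≡-Reasoning
    regroup : ∀ a b c e x → (a + b * x) + (c + e * x) ≡ a + c + (b + e) * x
    regroup = solve-∀
    split : m + n ≡ m % d + n % d + (m / d + n / d) * d
    split = trans (cong₂ _+_ (m≡m%n+[m/n]*n m d) (m≡m%n+[m/n]*n n d)) (regroup (m % d) (m / d) (n % d) (n / d) d)

  carry≤1 : ∀ m n → carry d m n ≤ 1
  carry≤1 m n = <⇒≤pred (m<n*o⇒m/o<n (begin-strict
    m % d + n % d <⟨ +-mono-< (m%n<n m d) (m%n<n n d) ⟩
    d + d         ≡⟨ cong (d +_) (sym (+-identityʳ d)) ⟩
    2 * d         ∎))
    where open ≤-Reasoning

  carry≢0⇒d≤m+n : ∀ m n → carry d m n ≢ 0 → d ≤ m + n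
  carry≢0⇒d≤m+n m n c≢0 = m/n≢0⇒n≤m λ [m+n]/d≡0 → c≢0 (n≤0⇒n≡0 (begin
    carry d m n                    ≤⟨ m≤n+m _ _ ⟩
    m / d + n / d + carry d m n    ≡⟨ [m+n]/d≡m/d+n/d+carry m n ⟨
    (m + n) / d                    ≡⟨ [m+n]/d≡0 ⟩
    0                              ∎))
    where open ≤-Reasoning

  [1+m]/d≡[1+m%d]/d+m/d : ∀ m → suc m / d ≡ suc (m % d) / d + m / d
  [1+m]/d≡[1+m%d]/d+m/d m = begin
    suc m / d                               ≡⟨ /-congˡ (cong suc (m≡m%n+[m/n]*n m d)) ⟩
    (suc (m % d) + (m / d) * d) / d         ≡⟨ +-distrib-/-∣ʳ (suc (m % d)) (n∣m*n (m / d)) ⟩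
    suc (m % d) / d + (m / d) * d / d       ≡⟨ cong (suc (m % d) / d +_) (m*n/n≡m (m / d) d) ⟩
    suc (m % d) / d + m / d                 ∎
    where open ≡-Reasoning

  ∣⇒[1+m]/d≡1+m/d : ∀ m → d ∣ suc m → suc m / d ≡ suc (m / d)
  ∣⇒[1+m]/d≡1+m/d m d∣ = trans ([1+m]/d≡[1+m%d]/d+m/d m) (cong (_+ m / d) (trans (/-congˡ 1+m%d≡d) (n/n≡1 d)))
    where
    1+m%d≡d : suc (m % d) ≡ d
    1+m%d≡d = trans (cong suc (%-pred-≡0 (n∣m⇒m%n≡0 _ d d∣))) (m+[n∸m]≡n (>-nonZero⁻¹ d))

  ∤⇒[1+m]/d≡m/d : ∀ m → ¬ d ∣ suc m → suc m / d ≡ m / d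
  ∤⇒[1+m]/d≡m/d m d∤ = trans ([1+m]/d≡[1+m%d]/d+m/d m) (cong (_+ m / d) (m<n⇒m/n≡0 1+m%d<d))
    where
    1+m%d<d : suc (m % d) < d
    1+m%d<d = ≤∧≢⇒< (m%n<n m d) λ 1+m%d≡d → d∤ (subst (d ∣_)
      (trans (cong (_+ (m / d) * d) (sym 1+m%d≡d)) (cong suc (sym (m≡m%n+[m/n]*n m d))))
      (∣m∣n⇒∣m+n ∣-refl (n∣m*n (m / d))))

d∣1+m+n⇒carry≡0 : ∀ d .{{_ : NonZero d}} m n → d ∣ suc (m + n) → carry d m n ≡ 0
d∣1+m+n⇒carry≡0 d@(suc r) m n d∣ with carry d m n in carry≡
... | zero = refl
... | suc c = contradiction (+-mono-≤ (<⇒≤pred (m%n<n m d)) (<⇒≤pred (m%n<n n d))) (<⇒≱ (begin-strict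
    r + r                ≡⟨ cong (_+ r) (sym s%d≡r) ⟩
    s % d + r            <⟨ +-monoʳ-< (s % d) (m≤m+n d (c * d)) ⟩
    s % d + suc c * d    ≡⟨ cong (λ q → s % d + q * d) carry≡ ⟨
    s % d + (s / d) * d  ≡⟨ m≡m%n+[m/n]*n s d ⟨
    s                    ∎))
  where
  open ≤-Reasoning
  s : ℕ
  s = m % d + n % d
  s%d≡r : s % d ≡ r
  s%d≡r = trans (sym (%-distribˡ-+ m n d)) (%-pred-≡0 (n∣m⇒m%n≡0 _ d d∣))

∑ : ℕ → (ℕ → ℕ) → ℕ
∑ zero    g = 0
∑ (suc m) g = ∑ m g + g (suc m)

syntax ∑ m (λ i → e) = ∑[ i ≤ m ] e

∑-cong : ∀ m {g h : ℕ → ℕ} → (∀ i → 1 ≤ i → i ≤ m → g i ≡ h i) → ∑ m g ≡ ∑ m h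
∑-cong zero    g≡h = refl
∑-cong (suc m) g≡h = cong₂ _+_ (∑-cong m λ i 1≤i i≤m → g≡h i 1≤i (m≤n⇒m≤1+n i≤m))
                               (g≡h (suc m) (s≤s z≤n) ≤-refl)

∑-mono-≤ : ∀ m {g h : ℕ → ℕ} → (∀ i → g i ≤ h i) → ∑ m g ≤ ∑ m h
∑-mono-≤ zero    g≤h = z≤n
∑-mono-≤ (suc m) g≤h = +-mono-≤ (∑-mono-≤ m g≤h) (g≤h (suc m))

∑-distrib-+ : ∀ m (g h : ℕ → ℕ) → ∑[ i ≤ m ] (g i + h i) ≡ ∑ m g + ∑ m h
∑-distrib-+ zero    g h = refl
∑-distrib-+ (suc m) g h = trans (cong (_+ (g (suc m) + h (suc m))) (∑-distrib-+ m g h))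
  (+-interchange (∑ m g) (∑ m h) (g (suc m)) (h (suc m)))
  where
  +-interchange : ∀ a b c e → a + b + (c + e) ≡ a + c + (b + e)
  +-interchange = solve-∀

∑-zero : ∀ m → ∑[ i ≤ m ] 0 ≡ 0
∑-zero zero    = refl
∑-zero (suc m) = trans (+-identityʳ _) (∑-zero m)

∑-comm : ∀ m e (g : ℕ → ℕ → ℕ) → ∑[ i ≤ m ] ∑[ t ≤ e ] g i t ≡ ∑[ t ≤ e ] ∑[ i ≤ m ] g i t
∑-comm zero    e g = sym (∑-zero e)
∑-comm (suc m) e g = trans (cong (_+ ∑[ t ≤ e ] g (suc m) t) (∑-comm m e g))
  (sym (∑-distrib-+ e (λ t → ∑[ i ≤ m ] g i t) (g (suc m))))

term≤∑ : ∀ m (g : ℕ → ℕ) {i} → 1 ≤ i → i ≤ m → g i ≤ ∑ m g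
term≤∑ zero    g (s≤s _) ()
term≤∑ (suc m) g {i} 1≤i i≤1+m with m≤n⇒m<n∨m≡n i≤1+m
... | inj₁ i<1+m = ≤-trans (term≤∑ m g 1≤i (<⇒≤pred i<1+m)) (m≤m+n _ _)
... | inj₂ refl  = m≤n+m _ _

𝟙[_≤_] : ℕ → ℕ → ℕ
𝟙[ zero  ≤ x     ] = 1
𝟙[ suc t ≤ zero  ] = 0
𝟙[ suc t ≤ suc x ] = 𝟙[ t ≤ x ]

≤⇒𝟙≡1 : ∀ {t x} → t ≤ x → 𝟙[ t ≤ x ] ≡ 1
≤⇒𝟙≡1 z≤n       = refl
≤⇒𝟙≡1 (s≤s t≤x) = ≤⇒𝟙≡1 t≤x

≰⇒𝟙≡0 : ∀ {t x} → ¬ t ≤ x → 𝟙[ t ≤ x ] ≡ 0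
≰⇒𝟙≡0 {zero}  {x}     t≰x = contradiction z≤n t≰x
≰⇒𝟙≡0 {suc t} {zero}  t≰x = refl
≰⇒𝟙≡0 {suc t} {suc x} t≰x = ≰⇒𝟙≡0 (t≰x ∘ s≤s)

∑𝟙≡⊓ : ∀ e x → ∑[ t ≤ e ] 𝟙[ t ≤ x ] ≡ e ⊓ x
∑𝟙≡⊓ zero    x = refl
∑𝟙≡⊓ (suc e) x = trans (cong (_+ 𝟙[ suc e ≤ x ]) (∑𝟙≡⊓ e x)) (sym (1+e⊓x e x))
  where
  1+e⊓x : ∀ e x → suc e ⊓ x ≡ e ⊓ x + 𝟙[ suc e ≤ x ]
  1+e⊓x e       zero    = sym (trans (+-identityʳ (e ⊓ 0)) (⊓-zeroʳ e))
  1+e⊓x zero    (suc x) = refl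
  1+e⊓x (suc e) (suc x) = cong suc (1+e⊓x e x)

≤1⇒≤𝟙 : ∀ {c t x} → c ≤ 1 → (c ≢ 0 → t ≤ x) → c ≤ 𝟙[ t ≤ x ]
≤1⇒≤𝟙 {zero}          _         _    = z≤n
≤1⇒≤𝟙 {suc zero}      _         t≤x  = ≤-reflexive (sym (≤⇒𝟙≡1 (t≤x λ ())))
≤1⇒≤𝟙 {suc (suc _)}   (s≤s ())  _

≤⇒∑𝟙≡ : ∀ {x e} → x ≤ e → ∑[ t ≤ e ] 𝟙[ t ≤ x ] ≡ x
≤⇒∑𝟙≡ {x} {e} x≤e = trans (∑𝟙≡⊓ e x) (trans (⊓-comm e x) (m≤n⇒m⊓n≡m x≤e))

∑𝟙≤ : ∀ e x → ∑[ t ≤ e ] 𝟙[ t ≤ x ] ≤ x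
∑𝟙≤ e x = subst (_≤ x) (sym (∑𝟙≡⊓ e x)) (m⊓n≤n e x)

extend-≤-suc : ∀ {N} (P : ℕ → Set) → (∀ i → 1 ≤ i → i ≤ N → P i) → P (suc N) →
  ∀ i → 1 ≤ i → i ≤ suc N → P i
extend-≤-suc P below top i 1≤i i≤1+N with m≤n⇒m<n∨m≡n i≤1+N
... | inj₁ i<1+N = below i 1≤i (<⇒≤pred i<1+N)
... | inj₂ refl  = top

module LevelSets (f : ℕ → ℕ) (f-gcd : ∀ i j → 1 ≤ i → 1 ≤ j → f (gcd i j) ≡ f i ⊓ f j) where

  f-mono : ∀ {i j} → 1 ≤ i → 1 ≤ j → i ∣ j → f i ≤ f j
  f-mono {i} {j} 1≤i 1≤j i∣j = subst (_≤ f j) (trans (sym (f-gcd i j 1≤i 1≤j)) (cong f gcd≡i)) (m⊓n≤n (f i) (f j))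
    where
    gcd≡i : gcd i j ≡ i
    gcd≡i = ∣-antisym (gcd[m,n]∣m i j) (gcd-greatest ∣-refl i∣j)

  PeriodicUpTo : ℕ → ℕ → ℕ → Set
  PeriodicUpTo t N ρ = ∀ i → 1 ≤ i → i ≤ N → t ≤ f i ⇔ ρ ∣ i

  unreached⇒periodic : ∀ {t N} → (∀ i → 1 ≤ i → i ≤ N → ¬ t ≤ f i) → PeriodicUpTo t N (suc N)
  unreached⇒periodic unreached i 1≤i i≤N =
    mk⇔ (⊥-elim ∘ unreached i 1≤i i≤N) (⊥-elim ∘ >⇒∤ {{>-nonZero 1≤i}} (s≤s i≤N))

  -- A level reached by no index up to N gets the period N + 1, which divides none of them.
  level-period : ∀ t N → Σ[ r ∈ ℕ ] PeriodicUpTo t N (suc r)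
  level-period t zero = 0 , λ { i (s≤s _) () }
  level-period t (suc N) with level-period t N
  ... | r , periodic with suc r ≤? N
  ...   | yes ρ≤N = r , extend-≤-suc _ periodic (mk⇔ reached⇒∣ ∣⇒reached)
    where
    1≤ρ : 1 ≤ suc r
    1≤ρ = s≤s z≤n
    t≤fρ : t ≤ f (suc r)
    t≤fρ = from (periodic (suc r) 1≤ρ ρ≤N) ∣-refl
    reached⇒∣ : t ≤ f (suc N) → suc r ∣ suc N
    reached⇒∣ t≤fN = ∣-trans (to (periodic g 1≤g g≤N) t≤fg) (gcd[m,n]∣n (suc r) (suc N))
      where
      g : ℕ
      g = gcd (suc r) (suc N)
      g≤N : g ≤ N
      g≤N = ≤-trans (∣⇒≤ (gcd[m,n]∣m (suc r) (suc N))) ρ≤N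
      1≤g : 1 ≤ g
      1≤g = n≢0⇒n>0 (gcd[m,n]≢0 (suc r) (suc N) (inj₁ λ ()))
      t≤fg : t ≤ f g
      t≤fg = subst (t ≤_) (sym (f-gcd (suc r) (suc N) 1≤ρ (s≤s z≤n))) (⊓-glb t≤fρ t≤fN)
    ∣⇒reached : suc r ∣ suc N → t ≤ f (suc N)
    ∣⇒reached ρ∣ = ≤-trans t≤fρ (f-mono 1≤ρ (s≤s z≤n) ρ∣)
  ...   | no ρ≰N = new-period (t ≤? f (suc N))
    where
    unreached : ∀ i → 1 ≤ i → i ≤ N → ¬ t ≤ f i
    unreached i 1≤i i≤N t≤fi = >⇒∤ {{>-nonZero 1≤i}} (≤-<-trans i≤N (≰⇒> ρ≰N)) (to (periodic i 1≤i i≤N) t≤fi)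
    new-period : Dec (t ≤ f (suc N)) → Σ[ r′ ∈ ℕ ] PeriodicUpTo t (suc N) (suc r′)
    new-period (yes t≤fN) = N , extend-≤-suc _ (unreached⇒periodic unreached) (mk⇔ (λ _ → ∣-refl) (λ _ → t≤fN))
    new-period (no t≰fN)  = suc N , unreached⇒periodic (extend-≤-suc _ unreached t≰fN)

  count : ℕ → ℕ → ℕ
  count t m = ∑[ i ≤ m ] 𝟙[ t ≤ f i ]

  periodic-restrict : ∀ {t N m ρ} → m ≤ N → PeriodicUpTo t N ρ → PeriodicUpTo t m ρ
  periodic-restrict m≤N periodic i 1≤i i≤m = periodic i 1≤i (≤-trans i≤m m≤N)

  periodic⇒count≡/ : ∀ {t r} m → PeriodicUpTo t m (suc r) → count t m ≡ m / suc r
  periodic⇒count≡/ zero periodic = refl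
  periodic⇒count≡/ {t} {r} (suc m) periodic = begin
    count t m + 𝟙[ t ≤ f (suc m) ]
      ≡⟨ cong (_+ 𝟙[ t ≤ f (suc m) ]) (periodic⇒count≡/ m (periodic-restrict (n≤1+n m) periodic)) ⟩
    m / suc r + 𝟙[ t ≤ f (suc m) ]
      ≡⟨ last-term (suc r ∣? suc m) ⟩
    suc m / suc r
      ∎
    where
    open ≡-Reasoning
    top : t ≤ f (suc m) ⇔ suc r ∣ suc m
    top = periodic (suc m) (s≤s z≤n) ≤-refl
    last-term : Dec (suc r ∣ suc m) → m / suc r + 𝟙[ t ≤ f (suc m) ] ≡ suc m / suc r
    last-term (yes ρ∣) = trans (cong (m / suc r +_) (≤⇒𝟙≡1 (from top ρ∣)))
                               (trans (+-comm _ 1) (sym (∣⇒[1+m]/d≡1+m/d (suc r) m ρ∣)))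
    last-term (no ρ∤)  = trans (cong (m / suc r +_) (≰⇒𝟙≡0 (ρ∤ ∘ to top)))
                               (trans (+-identityʳ _) (sym (∤⇒[1+m]/d≡m/d (suc r) m ρ∤)))

  ∑f≡∑count : ∀ {e} m → (∀ i → 1 ≤ i → i ≤ m → f i ≤ e) → ∑ m f ≡ ∑[ t ≤ e ] count t m
  ∑f≡∑count {e} m f≤e = trans (∑-cong m λ i 1≤i i≤m → sym (≤⇒∑𝟙≡ (f≤e i 1≤i i≤m)))
                              (∑-comm m e λ i t → 𝟙[ t ≤ f i ])

  module _ {n k : ℕ} (k≤n : k ≤ n) where

    count-split : ∀ {t r} → PeriodicUpTo t (suc n) (suc r) →
      count t n ≡ count t k + count t (n ∸ k) + carry (suc r) k (n ∸ k)
    count-split {t} {r} periodic = begin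
      count t n                                        ≡⟨ count≡ (n≤1+n n) ⟩
      n / suc r                                        ≡⟨ /-congˡ (m+[n∸m]≡n k≤n) ⟨
      (k + (n ∸ k)) / suc r                            ≡⟨ [m+n]/d≡m/d+n/d+carry (suc r) k (n ∸ k) ⟩
      k / suc r + (n ∸ k) / suc r + carry (suc r) k (n ∸ k)
        ≡⟨ cong (_+ carry (suc r) k (n ∸ k)) (cong₂ _+_ (count≡ (m≤n⇒m≤1+n k≤n)) (count≡ (m≤n⇒m≤1+n (m∸n≤m n k)))) ⟨
      count t k + count t (n ∸ k) + carry (suc r) k (n ∸ k) ∎
      where
      open ≡-Reasoning
      count≡ : ∀ {m} → m ≤ suc n → count t m ≡ m / suc r
      count≡ m≤N = periodic⇒count≡/ _ (periodic-restrict m≤N periodic)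

    count-superadditive : ∀ t → count t k + count t (n ∸ k) ≤ count t n
    count-superadditive t with level-period t (suc n)
    ... | r , periodic = subst (count t k + count t (n ∸ k) ≤_) (sym (count-split periodic)) (m≤m+n _ _)

    -- If t ≤ f (n + 1) then ρ_t ∣ n + 1 and there is no carry; a carry forces ρ_t ≤ n instead.
    count+𝟙≤ : ∀ {M} → (∀ i → 1 ≤ i → i ≤ suc n → f i ≤ M) → ∀ t →
      count t n + 𝟙[ t ≤ f (suc n) ] ≤ count t k + count t (n ∸ k) + 𝟙[ t ≤ M ]
    count+𝟙≤ {M} f≤M t with level-period t (suc n)
    ... | r , periodic rewrite count-split periodic with t ≤? f (suc n)
    ...   | yes t≤fN = ≤-reflexive (begin
      X + c + 𝟙[ t ≤ f (suc n) ] ≡⟨ cong₂ (λ c′ e → X + c′ + e) c≡0 (≤⇒𝟙≡1 t≤fN) ⟩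
      X + 0 + 1                  ≡⟨ cong (_+ 1) (+-identityʳ X) ⟩
      X + 1                      ≡⟨ cong (X +_) (≤⇒𝟙≡1 (≤-trans t≤fN (f≤M (suc n) (s≤s z≤n) ≤-refl))) ⟨
      X + 𝟙[ t ≤ M ]             ∎)
      where
      open ≡-Reasoning
      X : ℕ
      X = count t k + count t (n ∸ k)
      c : ℕ
      c = carry (suc r) k (n ∸ k)
      c≡0 : c ≡ 0
      c≡0 = d∣1+m+n⇒carry≡0 (suc r) k (n ∸ k)
        (subst (λ m → suc r ∣ suc m) (sym (m+[n∸m]≡n k≤n)) (to (periodic (suc n) (s≤s z≤n) ≤-refl) t≤fN))
    ...   | no t≰fN = begin
      X + c + 𝟙[ t ≤ f (suc n) ] ≡⟨ cong (X + c +_) (≰⇒𝟙≡0 t≰fN) ⟩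
      X + c + 0                  ≡⟨ +-identityʳ _ ⟩
      X + c                      ≤⟨ +-monoʳ-≤ X (≤1⇒≤𝟙 (carry≤1 (suc r) k (n ∸ k)) t≤M) ⟩
      X + 𝟙[ t ≤ M ]             ∎
      where
      open ≤-Reasoning
      X : ℕ
      X = count t k + count t (n ∸ k)
      c : ℕ
      c = carry (suc r) k (n ∸ k)
      t≤M : c ≢ 0 → t ≤ M
      t≤M c≢0 = ≤-trans (from (periodic (suc r) (s≤s z≤n) ρ≤1+n) ∣-refl) (f≤M (suc r) (s≤s z≤n) ρ≤1+n)
        where
        ρ≤1+n : suc r ≤ suc n
        ρ≤1+n = m≤n⇒m≤1+n (subst (suc r ≤_) (m+[n∸m]≡n k≤n) (carry≢0⇒d≤m+n (suc r) k (n ∸ k) c≢0))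

    private
      e : ℕ
      e = ∑ (suc n) f

      ∑f≡∑count≤1+n : ∀ {m} → m ≤ suc n → ∑ m f ≡ ∑[ t ≤ e ] count t m
      ∑f≡∑count≤1+n {m} m≤N = ∑f≡∑count m λ i 1≤i i≤m → term≤∑ (suc n) f 1≤i (≤-trans i≤m m≤N)

      ∑f+∑f≡ : ∑ k f + ∑ (n ∸ k) f ≡ ∑[ t ≤ e ] (count t k + count t (n ∸ k))
      ∑f+∑f≡ = trans (cong₂ _+_ (∑f≡∑count≤1+n (m≤n⇒m≤1+n k≤n)) (∑f≡∑count≤1+n (m≤n⇒m≤1+n (m∸n≤m n k))))
                     (sym (∑-distrib-+ e (λ t → count t k) (λ t → count t (n ∸ k))))

    ∑f-superadditive : ∑ k f + ∑ (n ∸ k) f ≤ ∑ n f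
    ∑f-superadditive = begin
      ∑ k f + ∑ (n ∸ k) f                        ≡⟨ ∑f+∑f≡ ⟩
      ∑[ t ≤ e ] (count t k + count t (n ∸ k))   ≤⟨ ∑-mono-≤ e count-superadditive ⟩
      ∑[ t ≤ e ] count t n                       ≡⟨ ∑f≡∑count≤1+n (n≤1+n n) ⟨
      ∑ n f                                      ∎
      where open ≤-Reasoning

    ∑f+f≤ : ∀ {M} → (∀ i → 1 ≤ i → i ≤ suc n → f i ≤ M) → ∑ n f + f (suc n) ≤ ∑ k f + ∑ (n ∸ k) f + M
    ∑f+f≤ {M} f≤M = begin
      ∑ n f + f (suc n)
        ≡⟨ cong₂ _+_ (∑f≡∑count≤1+n (n≤1+n n)) (sym (≤⇒∑𝟙≡ (term≤∑ (suc n) f (s≤s z≤n) ≤-refl))) ⟩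
      ∑[ t ≤ e ] count t n + ∑[ t ≤ e ] 𝟙[ t ≤ f (suc n) ]
        ≡⟨ ∑-distrib-+ e _ _ ⟨
      ∑[ t ≤ e ] (count t n + 𝟙[ t ≤ f (suc n) ])
        ≤⟨ ∑-mono-≤ e (count+𝟙≤ f≤M) ⟩
      ∑[ t ≤ e ] (count t k + count t (n ∸ k) + 𝟙[ t ≤ M ])
        ≡⟨ ∑-distrib-+ e _ _ ⟩
      ∑[ t ≤ e ] (count t k + count t (n ∸ k)) + ∑[ t ≤ e ] 𝟙[ t ≤ M ]
        ≤⟨ +-mono-≤ (≤-reflexive (sym ∑f+∑f≡)) (∑𝟙≤ e M) ⟩
      ∑ k f + ∑ (n ∸ k) f + M
        ∎
      where open ≤-Reasoning

^-monoʳ-∣ : ∀ m {a b} → a ≤ b → m ^ a ∣ m ^ b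
^-monoʳ-∣ m {a} {b} a≤b = divides (m ^ (b ∸ a)) (trans (cong (m ^_) (sym (m∸n+n≡m a≤b))) (^-distribˡ-+-* m (b ∸ a) a))

module Valuation {p : ℕ} (p-prime : Prime p) where

  private instance
    p≢0 : NonZero p
    p≢0 = prime⇒nonZero p-prime

  private
    1<p : 1 < p
    1<p = nonTrivial⇒n>1 p {{prime⇒nonTrivial p-prime}}

  Split : ℕ → Set
  Split x = Σ[ e ∈ ℕ ] Σ[ m ∈ ℕ ] x ≡ p ^ e * m × (x ≡ 0 ⊎ p ∤ m)

  split : ∀ x → Split x
  split = <-rec Split step
    where
    step : ∀ x → (∀ {y} → y < x → Split y) → Split x
    step zero    _   = 0 , 0 , refl , inj₁ refl
    step (suc x) rec with p ∣? suc x
    ... | no p∤x = 0 , suc x , sym (+-identityʳ (suc x)) , inj₂ p∤x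
    ... | yes (divides q 1+x≡q*p) with rec q<1+x
      where
      q<1+x : q < suc x
      q<1+x = subst (q <_) (sym 1+x≡q*p) (m<m*n q p {{≢-nonZero λ { refl → 0≢1+n (sym 1+x≡q*p) }}} 1<p)
    ... | e , m , q≡ , inj₁ q≡0 = contradiction (trans 1+x≡q*p (cong (_* p) q≡0)) λ ()
    ... | e , m , q≡ , inj₂ p∤m = suc e , m , trans 1+x≡q*p (trans (cong (_* p) q≡) (rotate (p ^ e) m p)) , inj₂ p∤m
      where
      rotate : ∀ a b c → a * b * c ≡ c * a * b
      rotate = solve-∀

  -- The p-adic valuation, with v 0 = 0.
  v : ℕ → ℕ
  v x = proj₁ (split x)

  cofactor : ℕ → ℕ
  cofactor x = proj₁ (proj₂ (split x))

  ≡p^v*cofactor : ∀ x → x ≡ p ^ v x * cofactor x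
  ≡p^v*cofactor x = proj₁ (proj₂ (proj₂ (split x)))

  p∤cofactor : ∀ {x} → 0 < x → p ∤ cofactor x
  p∤cofactor {x} 0<x with proj₂ (proj₂ (proj₂ (split x)))
  ... | inj₁ x≡0 = contradiction x≡0 (>⇒≢ 0<x)
  ... | inj₂ p∤ = p∤

  p∣p^[1+e]*m : ∀ e m → p ∣ p ^ suc e * m
  p∣p^[1+e]*m e m = ∣-trans (m∣m*n (p ^ e)) (m∣m*n m)

  p^-cancel-exponent : ∀ e e′ {m m′} → p ^ e * m ≡ p ^ e′ * m′ → p ∤ m → p ∤ m′ → e ≡ e′
  p^-cancel-exponent zero    zero     _  _   _    = refl
  p^-cancel-exponent zero    (suc e′) {m} {m′} eq p∤m _ =
    contradiction (subst (p ∣_) (trans (sym eq) (*-identityˡ m)) (p∣p^[1+e]*m e′ m′)) p∤m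
  p^-cancel-exponent (suc e) zero     {m} {m′} eq _ p∤m′ =
    contradiction (subst (p ∣_) (trans eq (*-identityˡ m′)) (p∣p^[1+e]*m e m)) p∤m′
  p^-cancel-exponent (suc e) (suc e′) eq p∤m p∤m′ = cong suc (p^-cancel-exponent e e′
    (*-cancelˡ-≡ _ _ p (trans (sym (*-assoc p (p ^ e) _)) (trans eq (*-assoc p (p ^ e′) _)))) p∤m p∤m′)

  v-unique : ∀ {x} e {m} → 0 < x → x ≡ p ^ e * m → p ∤ m → v x ≡ e
  v-unique {x} e 0<x x≡ p∤m = p^-cancel-exponent (v x) e (trans (sym (≡p^v*cofactor x)) x≡) (p∤cofactor 0<x) p∤m

  v-* : ∀ {x y} → 0 < x → 0 < y → v (x * y) ≡ v x + v y
  v-* {x} {y} 0<x 0<y = v-unique (v x + v y) (*-mono-≤ 0<x 0<y) x*y≡ p∤cx*cy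
    where
    x*y≡ : x * y ≡ p ^ (v x + v y) * (cofactor x * cofactor y)
    x*y≡ = begin
      x * y                                                ≡⟨ cong₂ _*_ (≡p^v*cofactor x) (≡p^v*cofactor y) ⟩
      p ^ v x * cofactor x * (p ^ v y * cofactor y)        ≡⟨ *-interchange (p ^ v x) (cofactor x) (p ^ v y) (cofactor y) ⟩
      p ^ v x * p ^ v y * (cofactor x * cofactor y)        ≡⟨ cong (_* (cofactor x * cofactor y)) (^-distribˡ-+-* p (v x) (v y)) ⟨
      p ^ (v x + v y) * (cofactor x * cofactor y)          ∎
      where
      open ≡-Reasoning
      *-interchange : ∀ a b c d → a * b * (c * d) ≡ a * c * (b * d)
      *-interchange = solve-∀
    p∤cx*cy : p ∤ cofactor x * cofactor y
    p∤cx*cy p∣ with euclidsLemma (cofactor x) (cofactor y) p-prime p∣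
    ... | inj₁ p∣cx = p∤cofactor 0<x p∣cx
    ... | inj₂ p∣cy = p∤cofactor 0<y p∣cy

  v-p^ : ∀ e → v (p ^ e) ≡ e
  v-p^ e = v-unique e (m^n>0 p e) (sym (*-identityʳ _)) (λ p∣1 → >⇒≢ 1<p (∣1⇒≡1 p∣1))

  p^v∣ : ∀ x → p ^ v x ∣ x
  p^v∣ x = divides (cofactor x) (trans (≡p^v*cofactor x) (*-comm _ (cofactor x)))

  e≤v⇒p^e∣ : ∀ {e x} → e ≤ v x → p ^ e ∣ x
  e≤v⇒p^e∣ {x = x} e≤v = ∣-trans (^-monoʳ-∣ p e≤v) (p^v∣ x)

  p^e∣⇒e≤v : ∀ {x} e → 0 < x → p ^ e ∣ x → e ≤ v x
  p^e∣⇒e≤v {x} e 0<x (divides q x≡q*p^e) = begin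
    e                 ≤⟨ m≤m+n e (v q) ⟩
    e + v q           ≡⟨ cong (_+ v q) (v-p^ e) ⟨
    v (p ^ e) + v q   ≡⟨ v-* (m^n>0 p e) 0<q ⟨
    v (p ^ e * q)     ≡⟨ cong v (trans x≡q*p^e (*-comm q _)) ⟨
    v x               ∎
    where
    open ≤-Reasoning
    0<q : 0 < q
    0<q = n≢0⇒n>0 λ { refl → >⇒≢ 0<x x≡q*p^e }

  v-mono-∣ : ∀ {x y} → 0 < y → x ∣ y → v x ≤ v y
  v-mono-∣ {x} 0<y x∣y = p^e∣⇒e≤v (v x) 0<y (∣-trans (p^v∣ x) x∣y)

  v-gcd : ∀ {x y} → 0 < x → 0 < y → v (gcd x y) ≡ v x ⊓ v y
  v-gcd {x} {y} 0<x 0<y = ≤-antisym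
    (⊓-glb (v-mono-∣ 0<x (gcd[m,n]∣m x y)) (v-mono-∣ 0<y (gcd[m,n]∣n x y)))
    (p^e∣⇒e≤v (v x ⊓ v y) 0<gcd (gcd-greatest (e≤v⇒p^e∣ {x = x} (m⊓n≤m (v x) (v y)))
                                              (e≤v⇒p^e∣ {x = y} (m⊓n≤n (v x) (v y)))))
    where
    0<gcd : 0 < gcd x y
    0<gcd = n≢0⇒n>0 (gcd[m,n]≢0 x y (inj₁ (>⇒≢ 0<x)))


prime-factor : ∀ x .{{_ : NonZero x}} → x ≢ 1 → Σ[ q ∈ ℕ ] Prime q × q ∣ x
prime-factor x x≢1 with factorise x
... | record { factors = [] ; isFactorisation = x≡1 } = contradiction x≡1 x≢1
... | record { factors = q ∷ qs ; isFactorisation = x≡ ; factorsPrime = q-prime ∷ _ } =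
  q , q-prime , divides (product qs) (trans x≡ (*-comm q (product qs)))

_≤ᵥ_ : ℕ → ℕ → Set
x ≤ᵥ y = ∀ {p} (p-prime : Prime p) → Valuation.v p-prime x ≤ Valuation.v p-prime y

v≤⇒∣ : ∀ {x y} → 0 < x → 0 < y → x ≤ᵥ y → x ∣ y
v≤⇒∣ {x} = <-rec (λ x → ∀ {y} → 0 < x → 0 < y → x ≤ᵥ y → x ∣ y) step x
  where
  step : ∀ x → (∀ {x′} → x′ < x → ∀ {y} → 0 < x′ → 0 < y → x′ ≤ᵥ y → x′ ∣ y) →
         ∀ {y} → 0 < x → 0 < y → x ≤ᵥ y → x ∣ y
  step x rec {y} 0<x 0<y v≤ with x ≟ 1
  ... | yes refl = 1∣ y
  ... | no x≢1 with prime-factor x {{>-nonZero 0<x}} x≢1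
  ...   | q , q-prime , q∣x@(divides x′ x≡x′*q) = subst₂ _∣_ (sym x≡x′*q) (sym y≡y′*q) (*-monoˡ-∣ q x′∣y′)
    where
    open Valuation q-prime using (p^e∣⇒e≤v; e≤v⇒p^e∣)
    q∣y : q ∣ y
    q∣y = subst (_∣ y) (*-identityʳ q) (e≤v⇒p^e∣ (≤-trans 1≤v[x] (v≤ q-prime)))
      where
      1≤v[x] : 1 ≤ Valuation.v q-prime x
      1≤v[x] = p^e∣⇒e≤v 1 0<x (subst (_∣ x) (sym (*-identityʳ q)) q∣x)
    y′ : ℕ
    y′ = quotient q∣y
    y≡y′*q : y ≡ y′ * q
    y≡y′*q = _∣_.equality q∣y
    0<q : 0 < q
    0<q = >-nonZero⁻¹ q {{prime⇒nonZero q-prime}}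
    0<x′ : 0 < x′
    0<x′ = n≢0⇒n>0 λ { refl → >⇒≢ 0<x x≡x′*q }
    0<y′ : 0 < y′
    0<y′ = n≢0⇒n>0 λ y′≡0 → >⇒≢ 0<y (trans y≡y′*q (cong (_* q) y′≡0))
    x′<x : x′ < x
    x′<x = subst (x′ <_) (sym x≡x′*q) (m<m*n x′ q {{>-nonZero 0<x′}} (nonTrivial⇒n>1 q {{prime⇒nonTrivial q-prime}}))
    x′∣y′ : x′ ∣ y′
    x′∣y′ = rec x′<x 0<x′ 0<y′ λ p-prime → let open Valuation p-prime using (v; v-*) in
      +-cancelʳ-≤ (v q) _ _ (subst₂ _≤_ (trans (cong v x≡x′*q) (v-* 0<x′ 0<q))
                                         (trans (cong v y≡y′*q) (v-* 0<y′ 0<q)) (v≤ p-prime))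

lcm-pos : ∀ {m n} → 0 < m → 0 < n → 0 < lcm m n
lcm-pos {m} {n} 0<m 0<n = n≢0⇒n>0 λ lcm≡0 → >⇒≢ (*-mono-≤ 0<m 0<n)
  (trans (sym (gcd*lcm m n)) (trans (cong (gcd m n *_) lcm≡0) (*-zeroʳ (gcd m n))))

lcmList-pos : ∀ {xs} → All (0 <_) xs → 0 < lcmList xs
lcmList-pos []           = s≤s z≤n
lcmList-pos (0<x ∷ 0<xs) = lcm-pos 0<x (lcmList-pos 0<xs)

lcmList-least : ∀ {xs c} → All (_∣ c) xs → lcmList xs ∣ c
lcmList-least {c = c} [] = 1∣ c
lcmList-least (x∣c ∷ xs∣c) = lcm-least x∣c (lcmList-least xs∣c)

∈⇒∣lcmList : ∀ {x xs} → x ∈ xs → x ∣ lcmList xs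
∈⇒∣lcmList {xs = y ∷ ys} (here refl) = m∣lcm[m,n] y (lcmList ys)
∈⇒∣lcmList {xs = y ∷ ys} (there x∈ys) = ∣-trans (∈⇒∣lcmList x∈ys) (n∣lcm[m,n] y (lcmList ys))

m*n∣o⇒m∣o÷n : ∀ {x c d} → 0 < d → x * d ∣ c → x ∣ c ÷ d
m*n∣o⇒m∣o÷n {x} {d = suc _} _ x*d∣c = m*n∣o⇒m∣o/n x _ x*d∣c

m∣o*n⇒m÷n∣o : ∀ {x c d} → 0 < d → d ∣ c → c ∣ x * d → c ÷ d ∣ x
m∣o*n⇒m÷n∣o {d = suc _} _ d∣c c∣x*d = m∣n*o⇒m/n∣o d∣c c∣x*d

m÷n*n≡m : ∀ {m d} → 0 < d → d ∣ m → (m ÷ d) * d ≡ m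
m÷n*n≡m {d = suc _} _ d∣m = m/n*n≡m d∣m

lcmList-upTo-least : ∀ (g : ℕ → ℕ) {c} N → (∀ {i} → i < N → g i ∣ c) → lcmList (map g (upTo N)) ∣ c
lcmList-upTo-least g N g∣c = lcmList-least (map⁺ (applyUpTo⁺₁ id N g∣c))

lcmList-upTo-pos : ∀ (g : ℕ → ℕ) N → (∀ {i} → i < N → 0 < g i) → 0 < lcmList (map g (upTo N))
lcmList-upTo-pos g N 0<g = lcmList-pos (map⁺ (applyUpTo⁺₁ id N 0<g))

∣lcmList-upTo : ∀ (g : ℕ → ℕ) {N i} → i < N → g i ∣ lcmList (map g (upTo N))
∣lcmList-upTo g i<N = ∈⇒∣lcmList (∈-map⁺ g (∈-upTo⁺ i<N))

module StrongDivisibility (a : ℕ → ℕ) (a-sds : IsStrongDivSeq a) where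

  a-pos : ∀ {i} → 1 ≤ i → 0 < a i
  a-pos = proj₁ a-sds _

  prodUpTo-pos : ∀ k → 0 < prodUpTo a k
  prodUpTo-pos zero    = s≤s z≤n
  prodUpTo-pos (suc k) = *-mono-≤ (prodUpTo-pos k) (a-pos (s≤s z≤n))

  fallingProd-pos : ∀ {n k} → k ≤ n → 0 < fallingProd a n k
  fallingProd-pos {k = zero}              _         = s≤s z≤n
  fallingProd-pos {suc n} {suc k} (s≤s k≤n) = *-mono-≤ (a-pos (s≤s z≤n)) (fallingProd-pos k≤n)

  module AtPrime {p} (p-prime : Prime p) where
    open Valuation p-prime public

    v∘a-gcd : ∀ i j → 1 ≤ i → 1 ≤ j → v (a (gcd i j)) ≡ v (a i) ⊓ v (a j)
    v∘a-gcd i j 1≤i 1≤j = trans (cong v (sym (proj₂ a-sds i j 1≤i 1≤j))) (v-gcd (a-pos 1≤i) (a-pos 1≤j))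

    open LevelSets (v ∘ a) v∘a-gcd public

    v-prodUpTo : ∀ k → v (prodUpTo a k) ≡ ∑ k (v ∘ a)
    v-prodUpTo zero    = v-p^ 0
    v-prodUpTo (suc k) = trans (v-* (prodUpTo-pos k) (a-pos (s≤s z≤n))) (cong (_+ v (a (suc k))) (v-prodUpTo k))

    v-fallingProd : ∀ {n k} → k ≤ n → v (fallingProd a n k) + ∑ (n ∸ k) (v ∘ a) ≡ ∑ n (v ∘ a)
    v-fallingProd {n} {zero}        _         = cong (_+ ∑ n (v ∘ a)) (v-p^ 0)
    v-fallingProd {suc n} {suc k} (s≤s k≤n) = begin
      v (a (suc n) * fallingProd a n k) + ∑ (n ∸ k) (v ∘ a)
        ≡⟨ cong (_+ ∑ (n ∸ k) (v ∘ a)) (v-* (a-pos (s≤s z≤n)) (fallingProd-pos k≤n)) ⟩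
      v (a (suc n)) + v (fallingProd a n k) + ∑ (n ∸ k) (v ∘ a)
        ≡⟨ +-assoc (v (a (suc n))) _ _ ⟩
      v (a (suc n)) + (v (fallingProd a n k) + ∑ (n ∸ k) (v ∘ a))
        ≡⟨ cong (v (a (suc n)) +_) (v-fallingProd k≤n) ⟩
      v (a (suc n)) + ∑ n (v ∘ a)
        ≡⟨ +-comm (v (a (suc n))) _ ⟩
      ∑ n (v ∘ a) + v (a (suc n))
        ∎
      where open ≡-Reasoning

  prodUpTo∣fallingProd : ∀ {n k} → k ≤ n → prodUpTo a k ∣ fallingProd a n k
  prodUpTo∣fallingProd {n} {k} k≤n = v≤⇒∣ (prodUpTo-pos k) (fallingProd-pos k≤n) λ p-prime →
    let open AtPrime p-prime in
    +-cancelʳ-≤ (∑ (n ∸ k) (v ∘ a)) _ _ (begin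
      v (prodUpTo a k) + ∑ (n ∸ k) (v ∘ a)       ≡⟨ cong (_+ ∑ (n ∸ k) (v ∘ a)) (v-prodUpTo k) ⟩
      ∑ k (v ∘ a) + ∑ (n ∸ k) (v ∘ a)            ≤⟨ ∑f-superadditive k≤n ⟩
      ∑ n (v ∘ a)                                ≡⟨ v-fallingProd k≤n ⟨
      v (fallingProd a n k) + ∑ (n ∸ k) (v ∘ a)  ∎)
    where open ≤-Reasoning

  binomA*prodUpTo : ∀ {n k} → k ≤ n → binomA a n k * prodUpTo a k ≡ fallingProd a n k
  binomA*prodUpTo {k = k} k≤n = m÷n*n≡m (prodUpTo-pos k) (prodUpTo∣fallingProd k≤n)

  binomA-pos : ∀ {n k} → k ≤ n → 0 < binomA a n k
  binomA-pos {k = k} k≤n = n≢0⇒n>0 λ b≡0 → >⇒≢ (fallingProd-pos k≤n)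
    (trans (sym (binomA*prodUpTo k≤n)) (cong (_* prodUpTo a k) b≡0))

  binomA-absorption : ∀ {n i} → i ≤ n → binomA a (suc n) (suc i) * a (suc i) ≡ binomA a n i * a (suc n)
  binomA-absorption {n} {i} i≤n = *-cancelʳ-≡ _ _ (prodUpTo a i) {{>-nonZero (prodUpTo-pos i)}} (begin
    B′ * a (suc i) * P             ≡⟨ rearrange B′ (a (suc i)) P ⟩
    B′ * (P * a (suc i))           ≡⟨ binomA*prodUpTo (s≤s i≤n) ⟩
    a (suc n) * fallingProd a n i  ≡⟨ cong (a (suc n) *_) (binomA*prodUpTo i≤n) ⟨
    a (suc n) * (B * P)            ≡⟨ rearrange′ (a (suc n)) B P ⟩
    B * a (suc n) * P              ∎)
    where
    open ≡-Reasoning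
    B′ : ℕ
    B′ = binomA a (suc n) (suc i)
    B : ℕ
    B = binomA a n i
    P : ℕ
    P = prodUpTo a i
    rearrange : ∀ x y z → x * y * z ≡ x * (z * y)
    rearrange = solve-∀
    rearrange′ : ∀ x y z → x * (y * z) ≡ y * x * z
    rearrange′ = solve-∀

  module _ {p} (p-prime : Prime p) where
    open AtPrime p-prime

    v-binomA : ∀ {n k} → k ≤ n → v (binomA a n k) + (∑ k (v ∘ a) + ∑ (n ∸ k) (v ∘ a)) ≡ ∑ n (v ∘ a)
    v-binomA {n} {k} k≤n = begin
      v (binomA a n k) + (∑ k (v ∘ a) + ∑ (n ∸ k) (v ∘ a))
        ≡⟨ +-assoc (v (binomA a n k)) (∑ k (v ∘ a)) (∑ (n ∸ k) (v ∘ a)) ⟨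
      v (binomA a n k) + ∑ k (v ∘ a) + ∑ (n ∸ k) (v ∘ a)
        ≡⟨ cong (_+ ∑ (n ∸ k) (v ∘ a)) v-B*P ⟨
      v (fallingProd a n k) + ∑ (n ∸ k) (v ∘ a)
        ≡⟨ v-fallingProd k≤n ⟩
      ∑ n (v ∘ a)
        ∎
      where
      open ≡-Reasoning
      v-B*P : v (fallingProd a n k) ≡ v (binomA a n k) + ∑ k (v ∘ a)
      v-B*P = trans (cong v (sym (binomA*prodUpTo k≤n)))
        (trans (v-* (binomA-pos k≤n) (prodUpTo-pos k)) (cong (v (binomA a n k) +_) (v-prodUpTo k)))

    v-binomA*a≤ : ∀ {n k M} → k ≤ n → (∀ i → 1 ≤ i → i ≤ suc n → v (a i) ≤ M) → v (binomA a n k * a (suc n)) ≤ M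
    v-binomA*a≤ {n} {k} {M} k≤n v∘a≤M = +-cancelˡ-≤ S _ _ (begin
      S + v (binomA a n k * a (suc n))        ≡⟨ cong (S +_) (v-* (binomA-pos k≤n) (a-pos (s≤s z≤n))) ⟩
      S + (v (binomA a n k) + v (a (suc n)))  ≡⟨ rearrange S (v (binomA a n k)) (v (a (suc n))) ⟩
      v (binomA a n k) + S + v (a (suc n))    ≡⟨ cong (_+ v (a (suc n))) (v-binomA k≤n) ⟩
      ∑ n (v ∘ a) + v (a (suc n))             ≤⟨ ∑f+f≤ k≤n v∘a≤M ⟩
      S + M                                   ∎)
      where
      open ≤-Reasoning
      S : ℕ
      S = ∑ k (v ∘ a) + ∑ (n ∸ k) (v ∘ a)
      rearrange : ∀ x y z → x + (y + z) ≡ y + x + z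
      rearrange = solve-∀

  lcmA : ℕ → ℕ
  lcmA N = lcmList (map (λ i → a (suc i)) (upTo N))

  lcmA-pos : ∀ N → 0 < lcmA N
  lcmA-pos N = lcmList-upTo-pos (λ i → a (suc i)) N λ _ → a-pos (s≤s z≤n)

  ∣lcmA : ∀ {j N} → 1 ≤ j → j ≤ N → a j ∣ lcmA N
  ∣lcmA {suc i} _ i<N = ∣lcmList-upTo (λ i → a (suc i)) i<N

  binomA*a∣lcmA : ∀ {n k} → k ≤ n → binomA a n k * a (suc n) ∣ lcmA (suc n)
  binomA*a∣lcmA {n} k≤n = v≤⇒∣ (*-mono-≤ (binomA-pos k≤n) (a-pos (s≤s z≤n))) (lcmA-pos (suc n)) λ p-prime →
    v-binomA*a≤ p-prime k≤n λ i 1≤i i≤1+n → Valuation.v-mono-∣ p-prime (lcmA-pos (suc n)) (∣lcmA 1≤i i≤1+n)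

  a∣binomA*a : ∀ {n i} → i ≤ n → a (suc i) ∣ binomA a n i * a (suc n)
  a∣binomA*a {n} {i} i≤n = divides (binomA a (suc n) (suc i)) (sym (binomA-absorption i≤n))

theorem1 : (a : ℕ → ℕ) → IsStrongDivSeq a → (n : ℕ) →
    lcmList (map (binomA a n) (upTo (suc n)))
      ≡ lcmList (map (λ i → a (suc i)) (upTo (suc n))) ÷ a (suc n)
theorem1 a a-sds n = ∣-antisym
  (lcmList-upTo-least (binomA a n) (suc n) λ k<1+n → m*n∣o⇒m∣o÷n 0<a (binomA*a∣lcmA (s≤s⁻¹ k<1+n)))
  (m∣o*n⇒m÷n∣o 0<a (∣lcmA (s≤s z≤n) ≤-refl) (lcmList-upTo-least (λ i → a (suc i)) (suc n) λ i<1+n →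
    ∣-trans (a∣binomA*a (s≤s⁻¹ i<1+n)) (*-monoˡ-∣ (a (suc n)) (∣lcmList-upTo (binomA a n) i<1+n))))
  where
  open StrongDivisibility a a-sds
  0<a : 0 < a (suc n)
  0<a = a-pos (s≤s z≤n)
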